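{- For every finite set $\Gamma$ of closed $\mathcal{L}$-formulas and every closed $\mathcal{L}$-formula $A$: $\Gamma\models^V_{\mathcal{W}_{\mathrm P}}A$ iff $\Gamma\models^V_{\mathcal{W}_{\mathrm P2}}A$.
   Context: Language: $\mathcal{L}$ is a first-order language with $\top,\bot$, connectives $\land,\lor,\to,\neg$ ($\neg$ primitive, distinct from $A\to\bot$), $\forall,\exists$, countably many variables, constants, function and predicate symbols, including a distinguished unary predicate $E$. $\mathcal{L}(D)$ adds constants $\overline d$ for $d\in D$. GN formulas: $N::=\bot\mid\neg A\mid N\land N\mid N\lor N\mid N\to N\mid\forall xN\mid\exists xN$; $\forall xA$/$\exists xA$ is global if $x$ occurs free in $A$ and all its free occurrences lie inside GN subformulas, local otherwise. Strict finitistic model $W=\langle K,\le,D,J,v\rangle$: rooted tree (countable branching, height $\le\omega$), nonempty constant domain $D$, compositional interpretation $J$ of closed $\mathcal{L}(D)$-terms with $J(\overline d)=d$, monotone extensions $P^{v(k)}\subseteq D^n$, strictness (values of all subterms of arguments of an atom true at $k$ lie in $E^{v(k)}$), finite verification (finitely many predicates with nonempty extension per node). Forcing on closed $\mathcal{L}(D)$-formulas: atoms via $v(k)$; $\top$ forced, $\bot$ not; $\land,\lor$ componentwise; $k\models A\to B$ iff every $k'\ge k$ forcing $A$ has some $k''\ge k'$ forcing $B$; $k\models\neg A$ iff no node forces $A$; $k\models\forall xA$ iff for all $d\in D$, $k\models\top\to A[\overline d/x]$ (global) or $k\models E(\overline d)\to A[\overline d/x]$ (local); $k\models\exists xA$ iff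 for some $d$, $k\models A[\overline d/x]$ (global) or $k\models E(\overline d)\land A[\overline d/x]$ (local). $W$ is prevalent if every closed $\mathcal{L}(D)$-formula forced at some node is prevalent (for each node $k$ some $k'\ge k$ forces it) and $E(\overline d)$ is prevalent for each $d\in D$. $\mathcal{W}_{\mathrm P}$: all prevalent models; $\mathcal{W}_{\mathrm P2}$: prevalent models with exactly two nodes $r<k$. For a class $\mathcal{C}$ and closed formulas, $\Gamma\models^V_{\mathcal{C}}A$ means that in every $W\in\mathcal{C}$ every node forcing all members of $\Gamma$ forces $A$. -}

module Defs where

open import Data.Nat using (ℕ; zero; suc; _≡ᵇ_)
open import Data.Bool using (Bool; true; false; _∧_; _∨_; if_then_else_)
open import Data.List using (List; []; _∷_; _++_)
open import Data.List.Relation.Unary.All using (All)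
import Data.List.Membership.Propositional as LMem
open import Data.Vec using (Vec; []; _∷_)
import Data.Vec.Membership.Propositional as VMem
open import Data.Product using (Σ; _×_; _,_; proj₁)
open import Data.Sum using (_⊎_)
open import Data.Unit using (⊤)
open import Data.Empty using (⊥)
open import Relation.Nullary using (¬_)
open import Relation.Binary.PropositionalEquality using (_≡_; _≢_)
open import Function.Bundles using (_⇔_)

-- A function symbol is a pair
-- (name , arity), constants are 0-ary function symbols; likewise a
-- predicate symbol is a pair (name , arity).  Terms and formulas are
-- parametrised by a set C of extra constants: the language L is C = ⊥,
-- the language L(D) is C = D (constant  dom d  stands for  d̄ ).

data Term (C : Set) : Set where
  var : ℕ → Term C
  dom : C → Term C
  fn  : (f n : ℕ) → Vec (Term C) n → Term C

data Fm (C : Set) : Set where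
  atom : (p n : ℕ) → Vec (Term C) n → Fm C
  ⊤'   : Fm C
  ⊥'   : Fm C
  _∧'_ : Fm C → Fm C → Fm C
  _∨'_ : Fm C → Fm C → Fm C
  _⇒'_ : Fm C → Fm C → Fm C
  ¬'_  : Fm C → Fm C
  ∀'   : ℕ → Fm C → Fm C
  ∃'   : ℕ → Fm C → Fm C

E-name : ℕ
E-name = 0

E' : {C : Set} → Term C → Fm C
E' t = atom E-name 1 (t ∷ [])

mutual
  embT : {D : Set} → Term ⊥ → Term D
  embT (var x) = var x
  embT (dom ())
  embT (fn f n ts) = fn f n (embV ts)

  embV : {D : Set} {n : ℕ} → Vec (Term ⊥) n → Vec (Term D) n
  embV [] = []
  embV (t ∷ ts) = embT t ∷ embV ts

emb : {D : Set} → Fm ⊥ → Fm D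
emb (atom p n ts) = atom p n (embV ts)
emb ⊤' = ⊤'
emb ⊥' = ⊥'
emb (A ∧' B) = emb A ∧' emb B
emb (A ∨' B) = emb A ∨' emb B
emb (A ⇒' B) = emb A ⇒' emb B
emb (¬' A) = ¬' emb A
emb (∀' x A) = ∀' x (emb A)
emb (∃' x A) = ∃' x (emb A)

mutual
  occT : {C : Set} → ℕ → Term C → Bool
  occT x (var y) = x ≡ᵇ y
  occT x (dom _) = false
  occT x (fn f n ts) = occV x ts

  occV : {C : Set} {n : ℕ} → ℕ → Vec (Term C) n → Bool
  occV x [] = false
  occV x (t ∷ ts) = occT x t ∨ occV x ts

occFree : {C : Set} → ℕ → Fm C → Bool
occFree x (atom p n ts) = occV x ts
occFree x ⊤' = false
occFree x ⊥' = false
occFree x (A ∧' B) = occFree x A ∨ occFree x B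
occFree x (A ∨' B) = occFree x A ∨ occFree x B
occFree x (A ⇒' B) = occFree x A ∨ occFree x B
occFree x (¬' A) = occFree x A
occFree x (∀' y A) = if x ≡ᵇ y then false else occFree x A
occFree x (∃' y A) = if x ≡ᵇ y then false else occFree x A

ClosedT : {C : Set} → Term C → Set
ClosedT t = ∀ x → occT x t ≡ false

Closed : {C : Set} → Fm C → Set
Closed A = ∀ x → occFree x A ≡ false

isGN : {C : Set} → Fm C → Bool
isGN (atom p n ts) = false
isGN ⊤' = false
isGN ⊥' = true
isGN (A ∧' B) = isGN A ∧ isGN B
isGN (A ∨' B) = isGN A ∧ isGN B
isGN (A ⇒' B) = isGN A ∧ isGN B
isGN (¬' A) = true
isGN (∀' y A) = isGN A
isGN (∃' y A) = isGN A

coveredGN : {C : Set} → ℕ → Fm C → Bool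
coveredGN x A = isGN A ∨ rest A
  where
  rest : _ → Bool
  rest (atom p n ts) = if occV x ts then false else true
  rest ⊤' = true
  rest ⊥' = true
  rest (A ∧' B) = coveredGN x A ∧ coveredGN x B
  rest (A ∨' B) = coveredGN x A ∧ coveredGN x B
  rest (A ⇒' B) = coveredGN x A ∧ coveredGN x B
  rest (¬' A) = coveredGN x A
  rest (∀' y A) = if x ≡ᵇ y then true else coveredGN x A
  rest (∃' y A) = if x ≡ᵇ y then true else coveredGN x A

-- ∀xA / ∃xA is global iff x occurs free in A and all its free
-- occurrences lie inside GN subformulas
global : {C : Set} → ℕ → Fm C → Bool
global x A = occFree x A ∧ coveredGN x A

data _⊑_ {C : Set} : Term C → Term C → Set where
  here  : ∀ {t} → t ⊑ t
  below : ∀ {s t f n} {ts : Vec (Term C) n} →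
          t VMem.∈ ts → s ⊑ t → s ⊑ fn f n ts

-- Trees: a rooted tree with countable branching and height ≤ ω is
-- (up to isomorphism) a nonempty prefix-closed set of finite sequences
-- of natural numbers, ordered by the prefix relation.

_≼_ : List ℕ → List ℕ → Set
s ≼ t = Σ (List ℕ) λ u → s ++ u ≡ t

record Model : Set₁ where
  field
    T        : List ℕ → Set
    root     : T []
    prefCl   : ∀ s u → T (s ++ u) → T s
    D        : Set
    d₀       : D                                   -- D nonempty
    fun      : (f n : ℕ) → Vec D n → D
    rel      : Σ (List ℕ) T → (p n : ℕ) → Vec D n → Set

  Node : Set
  Node = Σ (List ℕ) T

  _≤_ : Node → Node → Set
  k ≤ k' = proj₁ k ≼ proj₁ k'

  Env : Set
  Env = ℕ → D

  _[_↦_] : Env → ℕ → D → Env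
  (ρ [ x ↦ d ]) y = if y ≡ᵇ x then d else ρ y

  mutual
    eval : Env → Term D → D
    eval ρ (var x) = ρ x
    eval ρ (dom d) = d
    eval ρ (fn f n ts) = fun f n (evalV ρ ts)

    evalV : {n : ℕ} → Env → Vec (Term D) n → Vec D n
    evalV ρ [] = []
    evalV ρ (t ∷ ts) = eval ρ t ∷ evalV ρ ts

  -- interpretation J of closed L(D)-terms (environment irrelevant)
  J : Term D → D
  J = eval (λ _ → d₀)

  Ein : Node → D → Set
  Ein k d = rel k E-name 1 (d ∷ [])

  -- forcing of formulas under an environment for the free variables;
  -- for closed L(D)-formulas this is the paper's forcing, with
  -- A[d̄/x] handled by updating the environment.
  forceE : Node → Env → Fm D → Set
  forceE k ρ (atom p n ts) = rel k p n (evalV ρ ts)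
  forceE k ρ ⊤' = ⊤
  forceE k ρ ⊥' = ⊥
  forceE k ρ (A ∧' B) = forceE k ρ A × forceE k ρ B
  forceE k ρ (A ∨' B) = forceE k ρ A ⊎ forceE k ρ B
  forceE k ρ (A ⇒' B) =
    ∀ k' → k ≤ k' → forceE k' ρ A → Σ Node λ k'' → k' ≤ k'' × forceE k'' ρ B
  forceE k ρ (¬' A) = ∀ k' → ¬ forceE k' ρ A
  forceE k ρ (∀' x A) with global x A
  ... | true  = ∀ (d : D) k' → k ≤ k' → ⊤ →
                  Σ Node λ k'' → k' ≤ k'' × forceE k'' (ρ [ x ↦ d ]) A
  ... | false = ∀ (d : D) k' → k ≤ k' → Ein k' d →
                  Σ Node λ k'' → k' ≤ k'' × forceE k'' (ρ [ x ↦ d ]) A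
  forceE k ρ (∃' x A) with global x A
  ... | true  = Σ D λ d → forceE k (ρ [ x ↦ d ]) A
  ... | false = Σ D λ d → Ein k d × forceE k (ρ [ x ↦ d ]) A

  _⊩_ : Node → Fm D → Set
  k ⊩ A = forceE k (λ _ → d₀) A

  Prevalent : Fm D → Set
  Prevalent A = ∀ k → Σ Node λ k' → k ≤ k' × k' ⊩ A

record SFModel : Set₁ where
  field
    M : Model
  open Model M public
  field
    monotone : ∀ {k k'} → k ≤ k' → ∀ p n ds → rel k p n ds → rel k' p n ds
    strict   : ∀ k p n (ts : Vec (Term D) n) → (∀ t → t VMem.∈ ts → ClosedT t) →
               rel k p n (evalV (λ _ → d₀) ts) →
               ∀ t → t VMem.∈ ts → ∀ s → s ⊑ t → Ein k (J s)
    finVerif : ∀ k → Σ (List (ℕ × ℕ)) λ L →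
               ∀ p n ds → rel k p n ds → (p , n) LMem.∈ L

IsPrevalent : SFModel → Set
IsPrevalent W =
  (∀ A → Closed A → Σ Node (λ k → k ⊩ A) → Prevalent A)
  × (∀ d → Prevalent (E' (dom d)))
  where open SFModel W

TwoNodes : SFModel → Set
TwoNodes W = Σ (List ℕ) λ s → s ≢ [] × (∀ t → T t ⇔ (t ≡ [] ⊎ t ≡ s))
  where open SFModel W

W-P : SFModel → Set
W-P = IsPrevalent

W-P2 : SFModel → Set
W-P2 W = IsPrevalent W × TwoNodes W

Conseq : (SFModel → Set) → List (Fm ⊥) → Fm ⊥ → Set₁
Conseq 𝒞 Γ A = ∀ (W : SFModel) → 𝒞 W → ∀ (k : SFModel.Node W) →
  All (λ B → SFModel._⊩_ W k (emb B)) Γ → SFModel._⊩_ W k (emb A)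

{-# OPTIONS --safe #-}
module Submission where

-- A two-node prevalent model is in particular prevalent, which gives one direction.
-- For the other, collapse a prevalent model W onto a node k: the root of the collapse
-- carries the atoms true at k, the top node the atoms true anywhere in W, both cut
-- down to the finitely many predicates of Γ, A and E so that verification stays finite.
-- In a prevalent model every formula forced somewhere is prevalent, so whether a node
-- forces A ⇒ B, ¬ A or ∀x A depends only on which instances of A and B are forced
-- somewhere. Hence, by induction, the collapse and W satisfy the same formulas, and
-- then the root of the collapse forces exactly what k forces.

open import Defs
open import Data.Empty using (⊥)
open import Data.List using (List)
open import Data.List.Relation.Unary.All using (All)
open import Data.Product using (_×_)

open import Level using (0ℓ)
open import Data.Bool using (true; false)
open import Data.Nat using (ℕ)
open import Data.Unit using (⊤; tt)
open import Data.Product using (Σ; _,_; proj₁; proj₂; map₂; curry; uncurry)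
open import Data.Sum using (_⊎_; inj₁; inj₂)
open import Data.List using ([]; _∷_; _++_; concatMap)
open import Data.List.Properties using (++-assoc; ++-identityʳ)
import Data.List.Relation.Unary.All as All
open import Data.List.Relation.Unary.Any using (here; there)
open import Data.List.Membership.Propositional using (_∈_)
open import Data.List.Membership.Propositional.Properties using (∈-concat⁺′; ∈-map⁺)
open import Data.List.Relation.Binary.Subset.Propositional using (_⊆_)
open import Data.List.Relation.Binary.Subset.Propositional.Properties
  using (⊆-trans; xs⊆xs++ys; xs⊆ys++xs)
open import Data.Vec using (Vec; []; _∷_; map)
import Data.Vec.Membership.Propositional as VMem
open import Function.Base using (id; _∘_)
open import Function.Bundles using (_⇔_; mk⇔; Equivalence)
open import Function.Construct.Identity using (↠-id)
open import Function.Properties.Equivalence using (⇔-setoid)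
open import Function.Properties.Inverse using (↔⇒⇔)
open import Function.Related.TypeIsomorphisms using (Σ-distribˡ-⊎; →-cong-⇔; ¬-cong-⇔)
open import Data.Product.Function.NonDependent.Propositional using (_×-⇔_)
open import Data.Product.Function.Dependent.Propositional using (Σ-⇔)
open import Data.Sum.Function.Propositional using (_⊎-⇔_)
open import Relation.Nullary using (¬_)
open import Relation.Binary.PropositionalEquality using (_≡_; refl; sym; trans; cong; cong₂; subst)
open import Relation.Binary.Reasoning.Setoid (⇔-setoid 0ℓ)

open Equivalence using (to; from)

≼-refl : ∀ s → s ≼ s
≼-refl s = [] , ++-identityʳ s

≼-trans : ∀ {s t u} → s ≼ t → t ≼ u → s ≼ u
≼-trans {s} (v , s++v≡t) (w , t++w≡u) =
  v ++ w , trans (sym (++-assoc s v w)) (trans (cong (_++ w) s++v≡t) t++w≡u)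

Π-cong-⇔ : {I : Set} {P Q : I → Set} → (∀ i → P i ⇔ Q i) → (∀ i → P i) ⇔ (∀ i → Q i)
Π-cong-⇔ P⇔Q = mk⇔ (λ p i → to (P⇔Q i) (p i)) (λ q i → from (P⇔Q i) (q i))

module Forcing (W : SFModel) where
  open SFModel W

  forceE-mono : ∀ {k k'} → k ≤ k' → ∀ ρ B → forceE k ρ B → forceE k' ρ B
  forceE-mono k≤k' ρ (atom p n ts) f = monotone k≤k' p n _ f
  forceE-mono k≤k' ρ ⊤' f = f
  forceE-mono k≤k' ρ ⊥' ()
  forceE-mono k≤k' ρ (A ∧' B) (a , b) = forceE-mono k≤k' ρ A a , forceE-mono k≤k' ρ B b
  forceE-mono k≤k' ρ (A ∨' B) (inj₁ a) = inj₁ (forceE-mono k≤k' ρ A a)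
  forceE-mono k≤k' ρ (A ∨' B) (inj₂ b) = inj₂ (forceE-mono k≤k' ρ B b)
  forceE-mono k≤k' ρ (A ⇒' B) f k₁ k'≤k₁ = f k₁ (≼-trans k≤k' k'≤k₁)
  forceE-mono k≤k' ρ (¬' A) f = f
  forceE-mono k≤k' ρ (∀' x A) f with global x A
  ... | true  = λ d k₁ k'≤k₁ → f d k₁ (≼-trans k≤k' k'≤k₁)
  ... | false = λ d k₁ k'≤k₁ → f d k₁ (≼-trans k≤k' k'≤k₁)
  forceE-mono k≤k' ρ (∃' x A) f with global x A
  ... | true  = let (d , a) = f in d , forceE-mono k≤k' _ A a
  ... | false = let (d , e , a) = f in d , monotone k≤k' E-name 1 _ e , forceE-mono k≤k' _ A a

  Satisfiable : Env → Fm D → Set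
  Satisfiable ρ B = Σ Node λ m → forceE m ρ B

  uniform⇒satisfiable⇔ : ∀ {ρ} B {P : Set} → (∀ m → forceE m ρ B ⇔ P) → Satisfiable ρ B ⇔ P
  uniform⇒satisfiable⇔ B forced⇔P =
    mk⇔ (λ (m , f) → to (forced⇔P m) f) (λ p → ([] , root) , from (forced⇔P ([] , root)) p)

  ∨-satisfiable⇔ : ∀ {ρ} A B → Satisfiable ρ (A ∨' B) ⇔ (Satisfiable ρ A ⊎ Satisfiable ρ B)
  ∨-satisfiable⇔ A B = ↔⇒⇔ Σ-distribˡ-⊎

  ¬-forced⇔ : ∀ {ρ} A m → forceE m ρ (¬' A) ⇔ (¬ Satisfiable ρ A)
  ¬-forced⇔ A m = mk⇔ uncurry curry

module Prevalence (W : SFModel) (prevalent : IsPrevalent W) where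
  open SFModel W public
  open Forcing W public

  PrevalentUnder : Env → Fm D → Set
  PrevalentUnder ρ B = ∀ k → Σ Node λ k' → k ≤ k' × forceE k' ρ B

  E-prevalent : ∀ d k → Σ Node λ k' → k ≤ k' × Ein k' d
  E-prevalent = proj₂ prevalent

  private
    constants : ∀ {n} → Vec D n → Vec (Term D) n
    constants = map dom

    evalV-constants : ∀ {n} ρ (ds : Vec D n) → evalV ρ (constants ds) ≡ ds
    evalV-constants ρ [] = refl
    evalV-constants ρ (d ∷ ds) = cong (d ∷_) (evalV-constants ρ ds)

    constants-closed : ∀ {n} x (ds : Vec D n) → occV x (constants ds) ≡ false
    constants-closed x [] = refl
    constants-closed x (d ∷ ds) = constants-closed x ds

  satisfiable⇒prevalent : ∀ B {ρ} → Satisfiable ρ B → PrevalentUnder ρ B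
  satisfiable⇒prevalent (atom p n ts) {ρ} (m , r) k =
    let closedAtom = atom p n (constants (evalV ρ ts))
        (k' , k≤k' , r') = proj₁ prevalent closedAtom (λ x → constants-closed x (evalV ρ ts))
                             (m , subst (rel m p n) (sym (evalV-constants _ _)) r) k
    in k' , k≤k' , subst (rel k' p n) (evalV-constants _ _) r'
  satisfiable⇒prevalent ⊤' _ k = k , ≼-refl _ , tt
  satisfiable⇒prevalent (A ∧' B) (m , a , b) k =
    let (k₁ , k≤k₁ , a₁) = satisfiable⇒prevalent A (m , a) k
        (k₂ , k₁≤k₂ , b₂) = satisfiable⇒prevalent B (m , b) k₁
    in k₂ , ≼-trans k≤k₁ k₁≤k₂ , forceE-mono k₁≤k₂ _ A a₁ , b₂
  satisfiable⇒prevalent (A ∨' B) (m , inj₁ a) k =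
    let (k₁ , k≤k₁ , a₁) = satisfiable⇒prevalent A (m , a) k in k₁ , k≤k₁ , inj₁ a₁
  satisfiable⇒prevalent (A ∨' B) (m , inj₂ b) k =
    let (k₁ , k≤k₁ , b₁) = satisfiable⇒prevalent B (m , b) k in k₁ , k≤k₁ , inj₂ b₁
  satisfiable⇒prevalent (A ⇒' B) (m , h) k = k , ≼-refl _ , λ k₁ _ a₁ →
    let (m₁ , m≤m₁ , a) = satisfiable⇒prevalent A (k₁ , a₁) m
        (m₂ , _ , b) = h m₁ m≤m₁ a
    in satisfiable⇒prevalent B (m₂ , b) k₁
  satisfiable⇒prevalent (¬' A) (m , h) k = k , ≼-refl _ , h
  satisfiable⇒prevalent (∀' x A) (m , h) k with global x A
  ... | true  = k , ≼-refl _ , λ d k₁ _ _ →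
    let (m₁ , _ , a) = h d m (≼-refl _) tt in satisfiable⇒prevalent A (m₁ , a) k₁
  ... | false = k , ≼-refl _ , λ d k₁ _ _ →
    let (m₁ , m≤m₁ , e) = E-prevalent d m
        (m₂ , _ , a) = h d m₁ m≤m₁ e
    in satisfiable⇒prevalent A (m₂ , a) k₁
  satisfiable⇒prevalent (∃' x A) (m , h) k with global x A
  ... | true  = let (d , a) = h
                    (k₁ , k≤k₁ , a₁) = satisfiable⇒prevalent A (m , a) k
                in k₁ , k≤k₁ , d , a₁
  ... | false = let (d , _ , a) = h
                    (k₁ , k≤k₁ , a₁) = satisfiable⇒prevalent A (m , a) k
                    (k₂ , k₁≤k₂ , e) = E-prevalent d k₁
                in k₂ , ≼-trans k≤k₁ k₁≤k₂ , d , e , forceE-mono k₁≤k₂ _ A a₁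

  ∧-satisfiable⇔ : ∀ {ρ} A B → Satisfiable ρ (A ∧' B) ⇔ (Satisfiable ρ A × Satisfiable ρ B)
  ∧-satisfiable⇔ A B = mk⇔
    (λ (m , a , b) → (m , a) , (m , b))
    (λ ((m , a) , sB) → let (m' , m≤m' , b) = satisfiable⇒prevalent B sB m
                        in m' , forceE-mono m≤m' _ A a , b)

  ∃-satisfiable⇔ : ∀ {ρ} x A → Satisfiable ρ (∃' x A) ⇔ (Σ D λ d → Satisfiable (ρ [ x ↦ d ]) A)
  ∃-satisfiable⇔ x A with global x A
  ... | true  = mk⇔ (λ (m , d , a) → d , m , a) (λ (d , m , a) → m , d , a)
  ... | false = mk⇔ (λ (m , d , _ , a) → d , m , a)
    (λ (d , m , a) → let (m' , m≤m' , e) = E-prevalent d m in m' , d , e , forceE-mono m≤m' _ A a)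

  ⇒-forced⇔ : ∀ {ρ} A B m → forceE m ρ (A ⇒' B) ⇔ (Satisfiable ρ A → Satisfiable ρ B)
  ⇒-forced⇔ A B m = mk⇔
    (λ h sA → let (k₁ , m≤k₁ , a) = satisfiable⇒prevalent A sA m in map₂ proj₂ (h k₁ m≤k₁ a))
    (λ sA→sB k₁ _ a → satisfiable⇒prevalent B (sA→sB (k₁ , a)) k₁)

  guarded-∀⇔ : ∀ {ρ} x A m (G : Node → D → Set) → (∀ d k → Σ Node λ k' → k ≤ k' × G k' d) →
    (∀ d k' → m ≤ k' → G k' d → Σ Node λ k'' → k' ≤ k'' × forceE k'' (ρ [ x ↦ d ]) A)
    ⇔ (∀ d → Satisfiable (ρ [ x ↦ d ]) A)
  guarded-∀⇔ x A m G G-prevalent = mk⇔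
    (λ h d → let (k₁ , m≤k₁ , g) = G-prevalent d m in map₂ proj₂ (h d k₁ m≤k₁ g))
    (λ s d k' _ _ → satisfiable⇒prevalent A (s d) k')

  ∀-forced⇔ : ∀ {ρ} x A m → forceE m ρ (∀' x A) ⇔ (∀ d → Satisfiable (ρ [ x ↦ d ]) A)
  ∀-forced⇔ {ρ} x A m with global x A
  ... | true  = guarded-∀⇔ {ρ} x A m (λ _ _ → ⊤) (λ _ k → k , ≼-refl _ , tt)
  ... | false = guarded-∀⇔ {ρ} x A m Ein E-prevalent

PredsIn : {C : Set} → List (ℕ × ℕ) → Fm C → Set
PredsIn L (atom p n ts) = (p , n) ∈ L
PredsIn L ⊤' = ⊤
PredsIn L ⊥' = ⊤
PredsIn L (A ∧' B) = PredsIn L A × PredsIn L B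
PredsIn L (A ∨' B) = PredsIn L A × PredsIn L B
PredsIn L (A ⇒' B) = PredsIn L A × PredsIn L B
PredsIn L (¬' A) = PredsIn L A
PredsIn L (∀' x A) = PredsIn L A
PredsIn L (∃' x A) = PredsIn L A

preds : {C : Set} → Fm C → List (ℕ × ℕ)
preds (atom p n ts) = (p , n) ∷ []
preds ⊤' = []
preds ⊥' = []
preds (A ∧' B) = preds A ++ preds B
preds (A ∨' B) = preds A ++ preds B
preds (A ⇒' B) = preds A ++ preds B
preds (¬' A) = preds A
preds (∀' x A) = preds A
preds (∃' x A) = preds A

preds⊆⇒PredsIn : ∀ {C : Set} {L} (B : Fm C) → preds B ⊆ L → PredsIn L B
preds⊆⇒PredsIn-++ : ∀ {C : Set} {L} (A B : Fm C) → preds A ++ preds B ⊆ L → PredsIn L A × PredsIn L B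

preds⊆⇒PredsIn (atom p n ts) ⊆L = ⊆L (here refl)
preds⊆⇒PredsIn ⊤' _ = tt
preds⊆⇒PredsIn ⊥' _ = tt
preds⊆⇒PredsIn (A ∧' B) ⊆L = preds⊆⇒PredsIn-++ A B ⊆L
preds⊆⇒PredsIn (A ∨' B) ⊆L = preds⊆⇒PredsIn-++ A B ⊆L
preds⊆⇒PredsIn (A ⇒' B) ⊆L = preds⊆⇒PredsIn-++ A B ⊆L
preds⊆⇒PredsIn (¬' A) ⊆L = preds⊆⇒PredsIn A ⊆L
preds⊆⇒PredsIn (∀' x A) ⊆L = preds⊆⇒PredsIn A ⊆L
preds⊆⇒PredsIn (∃' x A) ⊆L = preds⊆⇒PredsIn A ⊆L

preds⊆⇒PredsIn-++ A B ⊆L =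
  preds⊆⇒PredsIn A (⊆-trans (xs⊆xs++ys _ _) ⊆L) , preds⊆⇒PredsIn B (⊆-trans (xs⊆ys++xs _ _) ⊆L)

module Collapse (W : SFModel) (prevalent : IsPrevalent W) (k : SFModel.Node W)
                (L : List (ℕ × ℕ)) (E∈L : (E-name , 1) ∈ L) where
  open Prevalence W prevalent

  TwoNodeTree : List ℕ → Set
  TwoNodeTree t = t ≡ [] ⊎ t ≡ 0 ∷ []

  twoNodeTree-prefixClosed : ∀ s u → TwoNodeTree (s ++ u) → TwoNodeTree s
  twoNodeTree-prefixClosed [] _ _ = inj₁ refl
  twoNodeTree-prefixClosed (_ ∷ []) _ (inj₂ refl) = inj₂ refl
  twoNodeTree-prefixClosed (_ ∷ _ ∷ _) _ (inj₂ ())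

  rel₂ : Σ (List ℕ) TwoNodeTree → (p n : ℕ) → Vec D n → Set
  rel₂ ([] , _) p n ds = (p , n) ∈ L × rel k p n ds
  rel₂ (_ ∷ _ , _) p n ds = (p , n) ∈ L × Σ Node λ m → rel m p n ds

  M₂ : Model
  M₂ = record { T = TwoNodeTree ; root = inj₁ refl ; prefCl = twoNodeTree-prefixClosed
              ; D = D ; d₀ = d₀ ; fun = fun ; rel = rel₂ }

  module M₂ = Model M₂

  eval₂≡eval : ∀ ρ t → M₂.eval ρ t ≡ eval ρ t
  evalV₂≡evalV : ∀ {n} ρ (ts : Vec (Term D) n) → M₂.evalV ρ ts ≡ evalV ρ ts

  eval₂≡eval ρ (var x) = refl
  eval₂≡eval ρ (dom d) = refl
  eval₂≡eval ρ (fn f n ts) = cong (fun f n) (evalV₂≡evalV ρ ts)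

  evalV₂≡evalV ρ [] = refl
  evalV₂≡evalV ρ (t ∷ ts) = cong₂ _∷_ (eval₂≡eval ρ t) (evalV₂≡evalV ρ ts)

  monotone₂ : ∀ {n n'} → n M₂.≤ n' → ∀ p a ds → rel₂ n p a ds → rel₂ n' p a ds
  monotone₂ {[] , _} {[] , _} _ _ _ _ r = r
  monotone₂ {[] , _} {_ ∷ _ , _} _ _ _ _ (p∈L , r) = p∈L , k , r
  monotone₂ {_ ∷ _ , _} {[] , _} (_ , ()) _ _ _ r
  monotone₂ {_ ∷ _ , _} {_ ∷ _ , _} _ _ _ _ r = r

  strict₂ : ∀ n p a (ts : Vec (Term D) a) → (∀ t → t VMem.∈ ts → ClosedT t) →
            rel₂ n p a (M₂.evalV (λ _ → d₀) ts) →
            ∀ t → t VMem.∈ ts → ∀ s → s ⊑ t → M₂.Ein n (M₂.J s)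
  strict₂ ([] , _) p a ts closed (_ , r) t t∈ts s s⊑t =
    E∈L , subst (Ein k) (sym (eval₂≡eval _ s))
                (strict k p a ts closed (subst (rel k p a) (evalV₂≡evalV _ ts) r) t t∈ts s s⊑t)
  strict₂ (_ ∷ _ , _) p a ts closed (_ , m , r) t t∈ts s s⊑t =
    E∈L , m , subst (Ein m) (sym (eval₂≡eval _ s))
                    (strict m p a ts closed (subst (rel m p a) (evalV₂≡evalV _ ts) r) t t∈ts s s⊑t)

  predicate∈L : ∀ n {p a ds} → rel₂ n p a ds → (p , a) ∈ L
  predicate∈L ([] , _) = proj₁
  predicate∈L (_ ∷ _ , _) = proj₁

  W₂ : SFModel
  W₂ = record
    { M = M₂
    ; monotone = monotone₂
    ; strict = strict₂
    ; finVerif = λ n → L , λ p a ds → predicate∈L n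
    }

  root₂ top₂ : M₂.Node
  root₂ = [] , inj₁ refl
  top₂ = 0 ∷ [] , inj₂ refl

  ≤top₂ : ∀ n → n M₂.≤ top₂
  ≤top₂ ([] , _) = 0 ∷ [] , refl
  ≤top₂ (_ ∷ _ , inj₂ refl) = [] , refl

  prevalent₂ : IsPrevalent W₂
  prevalent₂ =
    (λ B _ (n , f) n' → top₂ , ≤top₂ n' , Forcing.forceE-mono W₂ (≤top₂ n) _ B f) ,
    (λ d n' → top₂ , ≤top₂ n' , E∈L , let (m , _ , e) = E-prevalent d k in m , e)

  twoNodes₂ : TwoNodes W₂
  twoNodes₂ = 0 ∷ [] , (λ ()) , λ t → mk⇔ id id

  module W₂ = Prevalence W₂ prevalent₂

  satisfiable⇔ : ∀ B ρ → PredsIn L B → W₂.Satisfiable ρ B ⇔ Satisfiable ρ B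
  satisfiable⇔ (atom p n ts) ρ p∈L = mk⇔ to₂ from₂
    where
    to₂ : W₂.Satisfiable ρ (atom p n ts) → Satisfiable ρ (atom p n ts)
    to₂ (([] , _) , _ , r) = k , subst (rel k p n) (evalV₂≡evalV ρ ts) r
    to₂ ((_ ∷ _ , _) , _ , m , r) = m , subst (rel m p n) (evalV₂≡evalV ρ ts) r
    from₂ : Satisfiable ρ (atom p n ts) → W₂.Satisfiable ρ (atom p n ts)
    from₂ (m , r) = top₂ , p∈L , m , subst (rel m p n) (sym (evalV₂≡evalV ρ ts)) r
  satisfiable⇔ ⊤' ρ _ = mk⇔ (λ _ → k , tt) (λ _ → root₂ , tt)
  satisfiable⇔ ⊥' ρ _ = mk⇔ (λ ()) (λ ())
  satisfiable⇔ (A ∧' B) ρ (A∈L , B∈L) = begin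
    W₂.Satisfiable ρ (A ∧' B)                   ≈⟨ W₂.∧-satisfiable⇔ A B ⟩
    (W₂.Satisfiable ρ A × W₂.Satisfiable ρ B)   ≈⟨ satisfiable⇔ A ρ A∈L ×-⇔ satisfiable⇔ B ρ B∈L ⟩
    (Satisfiable ρ A × Satisfiable ρ B)         ≈⟨ ∧-satisfiable⇔ A B ⟨
    Satisfiable ρ (A ∧' B)                      ∎
  satisfiable⇔ (A ∨' B) ρ (A∈L , B∈L) = begin
    W₂.Satisfiable ρ (A ∨' B)                   ≈⟨ W₂.∨-satisfiable⇔ A B ⟩
    (W₂.Satisfiable ρ A ⊎ W₂.Satisfiable ρ B)   ≈⟨ satisfiable⇔ A ρ A∈L ⊎-⇔ satisfiable⇔ B ρ B∈L ⟩
    (Satisfiable ρ A ⊎ Satisfiable ρ B)         ≈⟨ ∨-satisfiable⇔ A B ⟨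
    Satisfiable ρ (A ∨' B)                      ∎
  satisfiable⇔ (A ⇒' B) ρ (A∈L , B∈L) = begin
    W₂.Satisfiable ρ (A ⇒' B)                   ≈⟨ W₂.uniform⇒satisfiable⇔ (A ⇒' B) (W₂.⇒-forced⇔ A B) ⟩
    (W₂.Satisfiable ρ A → W₂.Satisfiable ρ B)   ≈⟨ →-cong-⇔ (satisfiable⇔ A ρ A∈L) (satisfiable⇔ B ρ B∈L) ⟩
    (Satisfiable ρ A → Satisfiable ρ B)         ≈⟨ uniform⇒satisfiable⇔ (A ⇒' B) (⇒-forced⇔ A B) ⟨
    Satisfiable ρ (A ⇒' B)                      ∎
  satisfiable⇔ (¬' A) ρ A∈L = begin
    W₂.Satisfiable ρ (¬' A)                     ≈⟨ W₂.uniform⇒satisfiable⇔ (¬' A) (W₂.¬-forced⇔ A) ⟩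
    ¬ W₂.Satisfiable ρ A                        ≈⟨ ¬-cong-⇔ (satisfiable⇔ A ρ A∈L) ⟩
    ¬ Satisfiable ρ A                           ≈⟨ uniform⇒satisfiable⇔ (¬' A) (¬-forced⇔ A) ⟨
    Satisfiable ρ (¬' A)                        ∎
  satisfiable⇔ (∀' x A) ρ A∈L = begin
    W₂.Satisfiable ρ (∀' x A)                   ≈⟨ W₂.uniform⇒satisfiable⇔ (∀' x A) (W₂.∀-forced⇔ x A) ⟩
    (∀ d → W₂.Satisfiable (ρ [ x ↦ d ]) A)      ≈⟨ Π-cong-⇔ (λ d → satisfiable⇔ A (ρ [ x ↦ d ]) A∈L) ⟩
    (∀ d → Satisfiable (ρ [ x ↦ d ]) A)         ≈⟨ uniform⇒satisfiable⇔ (∀' x A) (∀-forced⇔ x A) ⟨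
    Satisfiable ρ (∀' x A)                      ∎
  satisfiable⇔ (∃' x A) ρ A∈L = begin
    W₂.Satisfiable ρ (∃' x A)                   ≈⟨ W₂.∃-satisfiable⇔ x A ⟩
    (Σ D λ d → W₂.Satisfiable (ρ [ x ↦ d ]) A)  ≈⟨ Σ-⇔ (↠-id D) (satisfiable⇔ A (ρ [ x ↦ _ ]) A∈L) ⟩
    (Σ D λ d → Satisfiable (ρ [ x ↦ d ]) A)     ≈⟨ ∃-satisfiable⇔ x A ⟨
    Satisfiable ρ (∃' x A)                      ∎

  root-forces⇔ : ∀ B ρ → PredsIn L B → W₂.forceE root₂ ρ B ⇔ forceE k ρ B
  root-forces⇔ (atom p n ts) ρ p∈L = mk⇔
    (λ (_ , r) → subst (rel k p n) (evalV₂≡evalV ρ ts) r)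
    (λ r → p∈L , subst (rel k p n) (sym (evalV₂≡evalV ρ ts)) r)
  root-forces⇔ ⊤' ρ _ = mk⇔ id id
  root-forces⇔ ⊥' ρ _ = mk⇔ id id
  root-forces⇔ (A ∧' B) ρ (A∈L , B∈L) = root-forces⇔ A ρ A∈L ×-⇔ root-forces⇔ B ρ B∈L
  root-forces⇔ (A ∨' B) ρ (A∈L , B∈L) = root-forces⇔ A ρ A∈L ⊎-⇔ root-forces⇔ B ρ B∈L
  root-forces⇔ (A ⇒' B) ρ (A∈L , B∈L) = begin
    W₂.forceE root₂ ρ (A ⇒' B)                  ≈⟨ W₂.⇒-forced⇔ A B root₂ ⟩
    (W₂.Satisfiable ρ A → W₂.Satisfiable ρ B)   ≈⟨ →-cong-⇔ (satisfiable⇔ A ρ A∈L) (satisfiable⇔ B ρ B∈L) ⟩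
    (Satisfiable ρ A → Satisfiable ρ B)         ≈⟨ ⇒-forced⇔ A B k ⟨
    forceE k ρ (A ⇒' B)                         ∎
  root-forces⇔ (¬' A) ρ A∈L = begin
    W₂.forceE root₂ ρ (¬' A)                    ≈⟨ W₂.¬-forced⇔ A root₂ ⟩
    ¬ W₂.Satisfiable ρ A                        ≈⟨ ¬-cong-⇔ (satisfiable⇔ A ρ A∈L) ⟩
    ¬ Satisfiable ρ A                           ≈⟨ ¬-forced⇔ A k ⟨
    forceE k ρ (¬' A)                           ∎
  root-forces⇔ (∀' x A) ρ A∈L = begin
    W₂.forceE root₂ ρ (∀' x A)                  ≈⟨ W₂.∀-forced⇔ x A root₂ ⟩
    (∀ d → W₂.Satisfiable (ρ [ x ↦ d ]) A)      ≈⟨ Π-cong-⇔ (λ d → satisfiable⇔ A (ρ [ x ↦ d ]) A∈L) ⟩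
    (∀ d → Satisfiable (ρ [ x ↦ d ]) A)         ≈⟨ ∀-forced⇔ x A k ⟨
    forceE k ρ (∀' x A)                         ∎
  root-forces⇔ (∃' x A) ρ A∈L with global x A
  ... | true  = Σ-⇔ (↠-id D) (root-forces⇔ A (ρ [ x ↦ _ ]) A∈L)
  ... | false = Σ-⇔ (↠-id D) (mk⇔ proj₂ (E∈L ,_) ×-⇔ root-forces⇔ A (ρ [ x ↦ _ ]) A∈L)

conseq-P2⇒conseq-P : ∀ Γ A → Conseq W-P2 Γ A → Conseq W-P Γ A
conseq-P2⇒conseq-P Γ A P2⊨A W prevalent k k⊩Γ =
  to (root-forces⇔ (emb A) _ (covered (here refl))) (P2⊨A W₂ (prevalent₂ , twoNodes₂) root₂ root₂⊩Γ)
  where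
  L : List (ℕ × ℕ)
  L = (E-name , 1) ∷ concatMap (preds ∘ emb) (A ∷ Γ)

  covered : ∀ {C} → C ∈ A ∷ Γ → PredsIn L (emb C)
  covered {C} C∈AΓ =
    preds⊆⇒PredsIn (emb C) λ q∈C → there (∈-concat⁺′ q∈C (∈-map⁺ (preds ∘ emb) C∈AΓ))

  open Collapse W prevalent k L (here refl)

  root₂⊩Γ : All (λ C → SFModel._⊩_ W₂ root₂ (emb C)) Γ
  root₂⊩Γ = All.tabulate λ {C} C∈Γ →
    from (root-forces⇔ (emb C) _ (covered (there C∈Γ))) (All.lookup k⊩Γ C∈Γ)

mainTheorem8 : (Γ : List (Fm ⊥)) (A : Fm ⊥) → All Closed Γ → Closed A →
    (Conseq W-P Γ A → Conseq W-P2 Γ A) × (Conseq W-P2 Γ A → Conseq W-P Γ A)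
mainTheorem8 Γ A _ _ = (λ P⊨A W (prevalent , _) → P⊨A W prevalent) , conseq-P2⇒conseq-P Γ A
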